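{- There exists an SBGDD$_0$ of type $3^6$.
   Context: For a multiset $\mathcal{B}$ of subsets of a set $V$ and $X \subseteq V$, the frequency of $X$ is the number of members of $\mathcal{B}$ (counted with multiplicity) containing $X$. An SBGDD$_\mu$ of type $g^u$ is a triple $(V,\Pi,\mathcal{B})$ where $V$ is a set of $gu$ points, $\Pi$ is a partition of $V$ into $u$ groups each of size $g$, and $\mathcal{B}$ is a multiset of 3-element subsets of $V$, such that every pair of points in the same group has frequency $0$, and the frequencies of pairs of points in different groups are pairwise distinct and form exactly the set $\{\mu,\dots,\mu+g^2\binom{u}{2}-1\}$. -}

module Defs where

open import Data.Nat using (ℕ; _+_; _*_; _∸_; _≤_; _<_)
open import Data.Nat.Combinatorics using (_C_)
open import Data.Fin using (Fin)
open import Data.Fin.Properties using (_≟_)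
open import Data.List using (List; length; filter; allFin)
open import Data.Product using (_×_; _,_; Σ; ∃)
open import Data.Sum using (_⊎_)
open import Relation.Nullary using (¬_; Dec)
open import Relation.Nullary.Decidable using (_×-dec_; _⊎-dec_)
open import Relation.Binary.PropositionalEquality using (_≡_)

-- A 3-element subset of Fin n: three pairwise distinct points
-- (order of listing is irrelevant for all notions below).
record Triple (n : ℕ) : Set where
  constructor triple
  field
    p₁ p₂ p₃ : Fin n
    d₁₂ : ¬ p₁ ≡ p₂
    d₁₃ : ¬ p₁ ≡ p₃
    d₂₃ : ¬ p₂ ≡ p₃
open Triple public

_∈T_ : ∀ {n} → Fin n → Triple n → Set
x ∈T t = (x ≡ p₁ t ⊎ x ≡ p₂ t) ⊎ x ≡ p₃ t

_∈T?_ : ∀ {n} (x : Fin n) (t : Triple n) → Dec (x ∈T t)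
x ∈T? t = ((x ≟ p₁ t) ⊎-dec (x ≟ p₂ t)) ⊎-dec (x ≟ p₃ t)

-- frequency of the pair {x , y} in the multiset (list) of blocks
freq : ∀ {n} → List (Triple n) → Fin n → Fin n → ℕ
freq B x y = length (filter (λ t → (x ∈T? t) ×-dec (y ∈T? t)) B)

groupSize : ∀ {n u} → (Fin n → Fin u) → Fin u → ℕ
groupSize {n} grp i = length (filter (λ x → grp x ≟ i) (allFin n))

-- SBGDD_μ of type g^u on the point set V = Fin (g * u).
-- The partition Π into u groups is given by a map grp assigning each point its group.
record SBGDD (μ g u : ℕ) : Set where
  field
    grp    : Fin (g * u) → Fin u
    blocks : List (Triple (g * u))
    groupSizes : ∀ i → groupSize grp i ≡ g
    sameGroup  : ∀ x y → ¬ x ≡ y → grp x ≡ grp y → freq blocks x y ≡ 0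
    distinctFreq : ∀ x y x' y' → ¬ grp x ≡ grp y → ¬ grp x' ≡ grp y' →
                   freq blocks x y ≡ freq blocks x' y' →
                   (x ≡ x' × y ≡ y') ⊎ (x ≡ y' × y ≡ x')
    freqInRange  : ∀ x y → ¬ grp x ≡ grp y →
                   μ ≤ freq blocks x y × freq blocks x y < μ + g * g * (u C 2)
    freqOnto     : ∀ k → μ ≤ k → k < μ + g * g * (u C 2) →
                   ∃ λ x → ∃ λ y → ¬ grp x ≡ grp y × freq blocks x y ≡ k

{-# OPTIONS --safe #-}
module Submission where

-- The design is explicit: a list of triples on the points 0 … 17, the group of x being
-- ⌊x/3⌋, each triple with a multiplicity.  All defining conditions are decided by
-- evaluation.  Distinctness and surjectivity of the cross-group frequencies are certified
-- by listing the 135 cross-group pairs in order of frequency: the k-th pair has frequency k,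
-- and the frequency of every cross-group pair is the position at which it is listed.

open import Defs
open import Data.Bool using (true; false; if_then_else_)
open import Data.Fin using (Fin; #_; quotient)
open import Data.Fin.Properties using (_≟_; all?)
open import Data.List using (List; []; _∷_; _++_; length; filter; replicate; head; drop)
open import Data.List.Properties using (filter-++; length-++)
open import Data.Maybe using (fromMaybe)
open import Data.Nat using (ℕ; zero; suc; _+_; _*_; _≤_; _<_; z≤n; _<?_)
open import Data.Nat.Combinatorics using (_C_)
open import Data.Nat.Properties using (allUpTo?) renaming (_≟_ to _≟ℕ_)
open import Data.Product using (_×_; _,_; proj₁; proj₂)
open import Data.Product.Properties using (≡-dec)
open import Data.Sum using (_⊎_; inj₁; inj₂)
open import Level using (Level)
open import Relation.Nullary using (¬_; Dec; does)
open import Relation.Nullary.Decidable using (_×-dec_; _⊎-dec_; _→-dec_; ¬?; toWitness; False; toWitnessFalse)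
open import Relation.Unary using (Pred; Decidable)
open import Relation.Binary.PropositionalEquality using (_≡_; refl; cong; cong₂; sym; trans; subst; module ≡-Reasoning)

private
  variable
    a p : Level
    A : Set a
    n : ℕ

length-filter-replicate : {P : Pred A p} (P? : Decidable P) (k : ℕ) (x : A) →
                          length (filter P? (replicate k x)) ≡ (if does (P? x) then k else 0)
length-filter-replicate P? zero    x with does (P? x)
... | true  = refl
... | false = refl
length-filter-replicate P? (suc k) x with does (P? x) | length-filter-replicate P? k x
... | true  | ih = cong suc ih
... | false | ih = ih

pairIn? : (x y : Fin n) (t : Triple n) → Dec (x ∈T t × y ∈T t)
pairIn? x y t = (x ∈T? t) ×-dec (y ∈T? t)

expand : List (Triple n × ℕ) → List (Triple n)
expand []            = []
expand ((t , k) ∷ B) = replicate k t ++ expand B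

weightedFreq : List (Triple n × ℕ) → Fin n → Fin n → ℕ
weightedFreq []            x y = 0
weightedFreq ((t , k) ∷ B) x y = (if does (pairIn? x y t) then k else 0) + weightedFreq B x y

freq-expand : (B : List (Triple n × ℕ)) (x y : Fin n) → freq (expand B) x y ≡ weightedFreq B x y
freq-expand []            x y = refl
freq-expand ((t , k) ∷ B) x y = begin
  length (filter (pairIn? x y) (replicate k t ++ expand B))
    ≡⟨ cong length (filter-++ (pairIn? x y) (replicate k t) (expand B)) ⟩
  length (filter (pairIn? x y) (replicate k t) ++ filter (pairIn? x y) (expand B))
    ≡⟨ length-++ (filter (pairIn? x y) (replicate k t)) ⟩
  length (filter (pairIn? x y) (replicate k t)) + freq (expand B) x y
    ≡⟨ cong₂ _+_ (length-filter-replicate (pairIn? x y) k t) (freq-expand B x y) ⟩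
  (if does (pairIn? x y t) then k else 0) + weightedFreq B x y
    ∎
  where open ≡-Reasoning

_≡ᵘ_ : A × A → A × A → Set _
p ≡ᵘ (x , y) = p ≡ (x , y) ⊎ p ≡ (y , x)

≡ᵘ-unique : {p : A × A} {x y x′ y′ : A} → p ≡ᵘ (x , y) → p ≡ᵘ (x′ , y′) →
            (x ≡ x′ × y ≡ y′) ⊎ (x ≡ y′ × y ≡ x′)
≡ᵘ-unique (inj₁ refl) (inj₁ refl) = inj₁ (refl , refl)
≡ᵘ-unique (inj₁ refl) (inj₂ refl) = inj₂ (refl , refl)
≡ᵘ-unique (inj₂ refl) (inj₁ refl) = inj₂ (refl , refl)
≡ᵘ-unique (inj₂ refl) (inj₂ refl) = inj₁ (refl , refl)

sbgdd-from-frequency-order :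
  {μ g u : ℕ} (grp : Fin (g * u) → Fin u) (blocks : List (Triple (g * u)))
  (f : Fin (g * u) → Fin (g * u) → ℕ) (order : ℕ → Fin (g * u) × Fin (g * u)) →
  (∀ x y → freq blocks x y ≡ f x y) →
  (∀ i → groupSize grp i ≡ g) →
  (∀ x y → ¬ x ≡ y → grp x ≡ grp y → f x y ≡ 0) →
  (∀ x y → ¬ grp x ≡ grp y →
     μ ≤ f x y × f x y < μ + g * g * (u C 2) × order (f x y) ≡ᵘ (x , y)) →
  (∀ {k} → μ ≤ k → k < μ + g * g * (u C 2) →
     ¬ grp (proj₁ (order k)) ≡ grp (proj₂ (order k)) × f (proj₁ (order k)) (proj₂ (order k)) ≡ k) →
  SBGDD μ g u
sbgdd-from-frequency-order grp blocks f order freq≡f sizes same-group listed attained = record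
  { grp          = grp
  ; blocks       = blocks
  ; groupSizes   = sizes
  ; sameGroup    = λ x y x≢y gx≡gy → trans (freq≡f x y) (same-group x y x≢y gx≡gy)
  ; distinctFreq = distinct
  ; freqInRange  = λ x y cross → subst (_ ≤_) (sym (freq≡f x y)) (proj₁ (listed x y cross))
                               , subst (_< _) (sym (freq≡f x y)) (proj₁ (proj₂ (listed x y cross)))
  ; freqOnto     = λ k μ≤k k<N → proj₁ (order k) , proj₂ (order k) , proj₁ (attained μ≤k k<N)
                               , trans (freq≡f _ _) (proj₂ (attained μ≤k k<N))
  }
  where
  distinct : ∀ x y x′ y′ → ¬ grp x ≡ grp y → ¬ grp x′ ≡ grp y′ → freq blocks x y ≡ freq blocks x′ y′ →
             (x ≡ x′ × y ≡ y′) ⊎ (x ≡ y′ × y ≡ x′)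
  distinct x y x′ y′ cross cross′ same = ≡ᵘ-unique
    (subst (λ k → order k ≡ᵘ (x , y)) f≡f′ (proj₂ (proj₂ (listed x y cross))))
    (proj₂ (proj₂ (listed x′ y′ cross′)))
    where
    f≡f′ : f x y ≡ f x′ y′
    f≡f′ = trans (sym (freq≡f x y)) (trans same (freq≡f x′ y′))

mkTriple : (x y z : Fin n) → {False (x ≟ y)} → {False (x ≟ z)} → {False (y ≟ z)} → Triple n
mkTriple x y z {x≢y} {x≢z} {y≢z} = triple x y z (toWitnessFalse x≢y) (toWitnessFalse x≢z) (toWitnessFalse y≢z)

_≟ₚ_ : (p q : Fin n × Fin n) → Dec (p ≡ q)
_≟ₚ_ = ≡-dec _≟_ _≟_

groupOf : Fin 18 → Fin 6
groupOf = quotient 3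

weightedBlocks : List (Triple 18 × ℕ)
weightedBlocks =
  (mkTriple (# 0) (# 3) (# 6) , 7) ∷
  (mkTriple (# 0) (# 3) (# 9) , 4) ∷
  (mkTriple (# 0) (# 3) (# 11) , 10) ∷
  (mkTriple (# 0) (# 3) (# 13) , 4) ∷
  (mkTriple (# 0) (# 4) (# 6) , 11) ∷
  (mkTriple (# 0) (# 4) (# 8) , 6) ∷
  (mkTriple (# 0) (# 4) (# 9) , 6) ∷
  (mkTriple (# 0) (# 4) (# 11) , 10) ∷
  (mkTriple (# 0) (# 4) (# 12) , 3) ∷
  (mkTriple (# 0) (# 4) (# 13) , 10) ∷
  (mkTriple (# 0) (# 4) (# 15) , 6) ∷
  (mkTriple (# 0) (# 4) (# 16) , 8) ∷
  (mkTriple (# 0) (# 4) (# 17) , 7) ∷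
  (mkTriple (# 0) (# 5) (# 6) , 10) ∷
  (mkTriple (# 0) (# 5) (# 7) , 12) ∷
  (mkTriple (# 0) (# 5) (# 8) , 4) ∷
  (mkTriple (# 0) (# 5) (# 9) , 8) ∷
  (mkTriple (# 0) (# 5) (# 10) , 10) ∷
  (mkTriple (# 0) (# 5) (# 11) , 10) ∷
  (mkTriple (# 0) (# 5) (# 12) , 5) ∷
  (mkTriple (# 0) (# 5) (# 13) , 12) ∷
  (mkTriple (# 0) (# 5) (# 15) , 6) ∷
  (mkTriple (# 0) (# 5) (# 16) , 1) ∷
  (mkTriple (# 0) (# 5) (# 17) , 17) ∷
  (mkTriple (# 0) (# 6) (# 9) , 8) ∷
  (mkTriple (# 0) (# 6) (# 10) , 11) ∷
  (mkTriple (# 0) (# 6) (# 11) , 12) ∷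
  (mkTriple (# 0) (# 6) (# 12) , 8) ∷
  (mkTriple (# 0) (# 6) (# 13) , 12) ∷
  (mkTriple (# 0) (# 6) (# 14) , 10) ∷
  (mkTriple (# 0) (# 6) (# 15) , 5) ∷
  (mkTriple (# 0) (# 6) (# 16) , 14) ∷
  (mkTriple (# 0) (# 6) (# 17) , 13) ∷
  (mkTriple (# 0) (# 7) (# 10) , 1) ∷
  (mkTriple (# 0) (# 7) (# 13) , 13) ∷
  (mkTriple (# 0) (# 8) (# 11) , 8) ∷
  (mkTriple (# 0) (# 8) (# 12) , 4) ∷
  (mkTriple (# 0) (# 8) (# 16) , 1) ∷
  (mkTriple (# 0) (# 8) (# 17) , 7) ∷
  (mkTriple (# 0) (# 9) (# 12) , 1) ∷
  (mkTriple (# 0) (# 9) (# 13) , 15) ∷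
  (mkTriple (# 0) (# 9) (# 14) , 1) ∷
  (mkTriple (# 0) (# 9) (# 15) , 9) ∷
  (mkTriple (# 0) (# 9) (# 16) , 5) ∷
  (mkTriple (# 0) (# 9) (# 17) , 11) ∷
  (mkTriple (# 0) (# 10) (# 12) , 15) ∷
  (mkTriple (# 0) (# 10) (# 13) , 5) ∷
  (mkTriple (# 0) (# 10) (# 15) , 9) ∷
  (mkTriple (# 0) (# 10) (# 16) , 6) ∷
  (mkTriple (# 0) (# 10) (# 17) , 13) ∷
  (mkTriple (# 0) (# 11) (# 12) , 5) ∷
  (mkTriple (# 0) (# 11) (# 13) , 15) ∷
  (mkTriple (# 0) (# 11) (# 15) , 11) ∷
  (mkTriple (# 0) (# 11) (# 17) , 5) ∷
  (mkTriple (# 0) (# 12) (# 15) , 1) ∷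
  (mkTriple (# 0) (# 12) (# 17) , 5) ∷
  (mkTriple (# 0) (# 13) (# 15) , 6) ∷
  (mkTriple (# 0) (# 13) (# 16) , 14) ∷
  (mkTriple (# 0) (# 13) (# 17) , 14) ∷
  (mkTriple (# 1) (# 3) (# 6) , 12) ∷
  (mkTriple (# 1) (# 3) (# 7) , 16) ∷
  (mkTriple (# 1) (# 3) (# 9) , 17) ∷
  (mkTriple (# 1) (# 3) (# 11) , 7) ∷
  (mkTriple (# 1) (# 3) (# 12) , 12) ∷
  (mkTriple (# 1) (# 3) (# 13) , 3) ∷
  (mkTriple (# 1) (# 3) (# 14) , 11) ∷
  (mkTriple (# 1) (# 3) (# 15) , 11) ∷
  (mkTriple (# 1) (# 3) (# 16) , 11) ∷
  (mkTriple (# 1) (# 4) (# 6) , 6) ∷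
  (mkTriple (# 1) (# 4) (# 9) , 13) ∷
  (mkTriple (# 1) (# 4) (# 12) , 2) ∷
  (mkTriple (# 1) (# 5) (# 6) , 3) ∷
  (mkTriple (# 1) (# 5) (# 7) , 13) ∷
  (mkTriple (# 1) (# 5) (# 8) , 5) ∷
  (mkTriple (# 1) (# 5) (# 9) , 11) ∷
  (mkTriple (# 1) (# 5) (# 10) , 8) ∷
  (mkTriple (# 1) (# 5) (# 11) , 1) ∷
  (mkTriple (# 1) (# 5) (# 12) , 12) ∷
  (mkTriple (# 1) (# 5) (# 13) , 4) ∷
  (mkTriple (# 1) (# 5) (# 14) , 1) ∷
  (mkTriple (# 1) (# 5) (# 15) , 11) ∷
  (mkTriple (# 1) (# 5) (# 16) , 4) ∷
  (mkTriple (# 1) (# 6) (# 9) , 10) ∷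
  (mkTriple (# 1) (# 6) (# 10) , 1) ∷
  (mkTriple (# 1) (# 6) (# 11) , 8) ∷
  (mkTriple (# 1) (# 6) (# 12) , 9) ∷
  (mkTriple (# 1) (# 6) (# 13) , 2) ∷
  (mkTriple (# 1) (# 6) (# 14) , 3) ∷
  (mkTriple (# 1) (# 6) (# 15) , 11) ∷
  (mkTriple (# 1) (# 6) (# 16) , 14) ∷
  (mkTriple (# 1) (# 6) (# 17) , 1) ∷
  (mkTriple (# 1) (# 7) (# 9) , 8) ∷
  (mkTriple (# 1) (# 7) (# 12) , 1) ∷
  (mkTriple (# 1) (# 7) (# 13) , 4) ∷
  (mkTriple (# 1) (# 7) (# 15) , 15) ∷
  (mkTriple (# 1) (# 7) (# 16) , 8) ∷
  (mkTriple (# 1) (# 8) (# 12) , 6) ∷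
  (mkTriple (# 1) (# 8) (# 16) , 12) ∷
  (mkTriple (# 1) (# 9) (# 12) , 12) ∷
  (mkTriple (# 1) (# 9) (# 13) , 9) ∷
  (mkTriple (# 1) (# 9) (# 14) , 11) ∷
  (mkTriple (# 1) (# 9) (# 15) , 8) ∷
  (mkTriple (# 1) (# 9) (# 16) , 9) ∷
  (mkTriple (# 1) (# 10) (# 12) , 11) ∷
  (mkTriple (# 1) (# 10) (# 14) , 1) ∷
  (mkTriple (# 1) (# 10) (# 15) , 11) ∷
  (mkTriple (# 1) (# 10) (# 16) , 6) ∷
  (mkTriple (# 1) (# 11) (# 12) , 1) ∷
  (mkTriple (# 1) (# 11) (# 13) , 1) ∷
  (mkTriple (# 1) (# 11) (# 15) , 11) ∷
  (mkTriple (# 1) (# 11) (# 16) , 2) ∷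
  (mkTriple (# 1) (# 12) (# 15) , 11) ∷
  (mkTriple (# 1) (# 12) (# 16) , 11) ∷
  (mkTriple (# 1) (# 13) (# 15) , 15) ∷
  (mkTriple (# 1) (# 13) (# 16) , 7) ∷
  (mkTriple (# 2) (# 3) (# 7) , 4) ∷
  (mkTriple (# 2) (# 3) (# 9) , 11) ∷
  (mkTriple (# 2) (# 3) (# 12) , 2) ∷
  (mkTriple (# 2) (# 3) (# 13) , 9) ∷
  (mkTriple (# 2) (# 3) (# 15) , 16) ∷
  (mkTriple (# 2) (# 4) (# 6) , 6) ∷
  (mkTriple (# 2) (# 4) (# 8) , 12) ∷
  (mkTriple (# 2) (# 4) (# 9) , 4) ∷
  (mkTriple (# 2) (# 4) (# 11) , 1) ∷
  (mkTriple (# 2) (# 4) (# 12) , 4) ∷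
  (mkTriple (# 2) (# 4) (# 13) , 8) ∷
  (mkTriple (# 2) (# 4) (# 16) , 1) ∷
  (mkTriple (# 2) (# 5) (# 6) , 3) ∷
  (mkTriple (# 2) (# 5) (# 7) , 16) ∷
  (mkTriple (# 2) (# 5) (# 8) , 14) ∷
  (mkTriple (# 2) (# 5) (# 9) , 8) ∷
  (mkTriple (# 2) (# 5) (# 10) , 8) ∷
  (mkTriple (# 2) (# 5) (# 12) , 8) ∷
  (mkTriple (# 2) (# 5) (# 13) , 13) ∷
  (mkTriple (# 2) (# 5) (# 14) , 1) ∷
  (mkTriple (# 2) (# 5) (# 15) , 18) ∷
  (mkTriple (# 2) (# 5) (# 16) , 1) ∷
  (mkTriple (# 2) (# 6) (# 9) , 6) ∷
  (mkTriple (# 2) (# 6) (# 12) , 8) ∷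
  (mkTriple (# 2) (# 6) (# 13) , 1) ∷
  (mkTriple (# 2) (# 6) (# 15) , 15) ∷
  (mkTriple (# 2) (# 7) (# 9) , 14) ∷
  (mkTriple (# 2) (# 7) (# 13) , 10) ∷
  (mkTriple (# 2) (# 7) (# 15) , 17) ∷
  (mkTriple (# 2) (# 7) (# 16) , 1) ∷
  (mkTriple (# 2) (# 8) (# 9) , 11) ∷
  (mkTriple (# 2) (# 8) (# 10) , 2) ∷
  (mkTriple (# 2) (# 8) (# 11) , 13) ∷
  (mkTriple (# 2) (# 8) (# 12) , 14) ∷
  (mkTriple (# 2) (# 8) (# 13) , 19) ∷
  (mkTriple (# 2) (# 8) (# 15) , 13) ∷
  (mkTriple (# 2) (# 8) (# 16) , 8) ∷
  (mkTriple (# 2) (# 9) (# 12) , 13) ∷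
  (mkTriple (# 2) (# 9) (# 13) , 10) ∷
  (mkTriple (# 2) (# 9) (# 14) , 8) ∷
  (mkTriple (# 2) (# 9) (# 15) , 8) ∷
  (mkTriple (# 2) (# 9) (# 16) , 10) ∷
  (mkTriple (# 2) (# 9) (# 17) , 7) ∷
  (mkTriple (# 2) (# 10) (# 13) , 1) ∷
  (mkTriple (# 2) (# 10) (# 15) , 8) ∷
  (mkTriple (# 2) (# 11) (# 12) , 2) ∷
  (mkTriple (# 2) (# 11) (# 13) , 15) ∷
  (mkTriple (# 2) (# 11) (# 15) , 16) ∷
  (mkTriple (# 2) (# 11) (# 16) , 1) ∷
  (mkTriple (# 2) (# 12) (# 15) , 11) ∷
  (mkTriple (# 2) (# 12) (# 16) , 1) ∷
  (mkTriple (# 2) (# 13) (# 15) , 11) ∷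
  (mkTriple (# 2) (# 13) (# 16) , 18) ∷
  (mkTriple (# 2) (# 13) (# 17) , 1) ∷
  (mkTriple (# 3) (# 6) (# 9) , 11) ∷
  (mkTriple (# 3) (# 6) (# 11) , 17) ∷
  (mkTriple (# 3) (# 6) (# 12) , 18) ∷
  (mkTriple (# 3) (# 6) (# 13) , 10) ∷
  (mkTriple (# 3) (# 6) (# 14) , 18) ∷
  (mkTriple (# 3) (# 6) (# 15) , 11) ∷
  (mkTriple (# 3) (# 6) (# 16) , 8) ∷
  (mkTriple (# 3) (# 6) (# 17) , 3) ∷
  (mkTriple (# 3) (# 7) (# 9) , 11) ∷
  (mkTriple (# 3) (# 7) (# 11) , 1) ∷
  (mkTriple (# 3) (# 7) (# 13) , 15) ∷
  (mkTriple (# 3) (# 7) (# 14) , 1) ∷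
  (mkTriple (# 3) (# 7) (# 15) , 11) ∷
  (mkTriple (# 3) (# 8) (# 11) , 12) ∷
  (mkTriple (# 3) (# 8) (# 12) , 1) ∷
  (mkTriple (# 3) (# 9) (# 12) , 13) ∷
  (mkTriple (# 3) (# 9) (# 13) , 13) ∷
  (mkTriple (# 3) (# 9) (# 14) , 9) ∷
  (mkTriple (# 3) (# 9) (# 15) , 16) ∷
  (mkTriple (# 3) (# 9) (# 16) , 9) ∷
  (mkTriple (# 3) (# 9) (# 17) , 8) ∷
  (mkTriple (# 3) (# 10) (# 15) , 2) ∷
  (mkTriple (# 3) (# 11) (# 12) , 6) ∷
  (mkTriple (# 3) (# 11) (# 13) , 10) ∷
  (mkTriple (# 3) (# 11) (# 14) , 13) ∷
  (mkTriple (# 3) (# 11) (# 15) , 19) ∷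
  (mkTriple (# 3) (# 11) (# 16) , 2) ∷
  (mkTriple (# 3) (# 11) (# 17) , 1) ∷
  (mkTriple (# 3) (# 12) (# 15) , 15) ∷
  (mkTriple (# 3) (# 12) (# 17) , 5) ∷
  (mkTriple (# 3) (# 13) (# 15) , 15) ∷
  (mkTriple (# 3) (# 13) (# 16) , 2) ∷
  (mkTriple (# 3) (# 14) (# 15) , 8) ∷
  (mkTriple (# 3) (# 14) (# 16) , 1) ∷
  (mkTriple (# 4) (# 6) (# 9) , 21) ∷
  (mkTriple (# 4) (# 6) (# 10) , 8) ∷
  (mkTriple (# 4) (# 6) (# 11) , 10) ∷
  (mkTriple (# 4) (# 6) (# 12) , 12) ∷
  (mkTriple (# 4) (# 6) (# 13) , 7) ∷
  (mkTriple (# 4) (# 6) (# 14) , 6) ∷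
  (mkTriple (# 4) (# 6) (# 15) , 11) ∷
  (mkTriple (# 4) (# 6) (# 16) , 7) ∷
  (mkTriple (# 4) (# 6) (# 17) , 7) ∷
  (mkTriple (# 4) (# 7) (# 9) , 12) ∷
  (mkTriple (# 4) (# 7) (# 13) , 3) ∷
  (mkTriple (# 4) (# 8) (# 9) , 7) ∷
  (mkTriple (# 4) (# 8) (# 11) , 11) ∷
  (mkTriple (# 4) (# 8) (# 12) , 10) ∷
  (mkTriple (# 4) (# 8) (# 13) , 11) ∷
  (mkTriple (# 4) (# 8) (# 15) , 4) ∷
  (mkTriple (# 4) (# 8) (# 16) , 8) ∷
  (mkTriple (# 4) (# 8) (# 17) , 8) ∷
  (mkTriple (# 4) (# 9) (# 12) , 7) ∷
  (mkTriple (# 4) (# 9) (# 13) , 8) ∷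
  (mkTriple (# 4) (# 9) (# 15) , 12) ∷
  (mkTriple (# 4) (# 9) (# 16) , 10) ∷
  (mkTriple (# 4) (# 9) (# 17) , 5) ∷
  (mkTriple (# 4) (# 10) (# 13) , 1) ∷
  (mkTriple (# 4) (# 10) (# 15) , 3) ∷
  (mkTriple (# 4) (# 11) (# 12) , 10) ∷
  (mkTriple (# 4) (# 11) (# 13) , 13) ∷
  (mkTriple (# 4) (# 11) (# 15) , 5) ∷
  (mkTriple (# 4) (# 11) (# 16) , 4) ∷
  (mkTriple (# 4) (# 12) (# 15) , 4) ∷
  (mkTriple (# 4) (# 12) (# 16) , 1) ∷
  (mkTriple (# 4) (# 12) (# 17) , 1) ∷
  (mkTriple (# 4) (# 13) (# 15) , 10) ∷
  (mkTriple (# 4) (# 13) (# 16) , 7) ∷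
  (mkTriple (# 4) (# 13) (# 17) , 1) ∷
  (mkTriple (# 5) (# 6) (# 9) , 7) ∷
  (mkTriple (# 5) (# 6) (# 10) , 10) ∷
  (mkTriple (# 5) (# 6) (# 11) , 2) ∷
  (mkTriple (# 5) (# 6) (# 12) , 9) ∷
  (mkTriple (# 5) (# 6) (# 15) , 5) ∷
  (mkTriple (# 5) (# 6) (# 16) , 1) ∷
  (mkTriple (# 5) (# 6) (# 17) , 2) ∷
  (mkTriple (# 5) (# 7) (# 9) , 14) ∷
  (mkTriple (# 5) (# 7) (# 10) , 11) ∷
  (mkTriple (# 5) (# 7) (# 12) , 1) ∷
  (mkTriple (# 5) (# 7) (# 13) , 13) ∷
  (mkTriple (# 5) (# 7) (# 15) , 19) ∷
  (mkTriple (# 5) (# 7) (# 17) , 8) ∷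
  (mkTriple (# 5) (# 8) (# 9) , 5) ∷
  (mkTriple (# 5) (# 8) (# 10) , 7) ∷
  (mkTriple (# 5) (# 8) (# 11) , 8) ∷
  (mkTriple (# 5) (# 8) (# 12) , 12) ∷
  (mkTriple (# 5) (# 8) (# 13) , 9) ∷
  (mkTriple (# 5) (# 8) (# 15) , 4) ∷
  (mkTriple (# 5) (# 8) (# 16) , 8) ∷
  (mkTriple (# 5) (# 8) (# 17) , 7) ∷
  (mkTriple (# 5) (# 9) (# 12) , 10) ∷
  (mkTriple (# 5) (# 9) (# 13) , 18) ∷
  (mkTriple (# 5) (# 9) (# 14) , 8) ∷
  (mkTriple (# 5) (# 9) (# 15) , 15) ∷
  (mkTriple (# 5) (# 9) (# 16) , 9) ∷
  (mkTriple (# 5) (# 9) (# 17) , 12) ∷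
  (mkTriple (# 5) (# 10) (# 12) , 13) ∷
  (mkTriple (# 5) (# 10) (# 13) , 7) ∷
  (mkTriple (# 5) (# 10) (# 15) , 5) ∷
  (mkTriple (# 5) (# 10) (# 16) , 2) ∷
  (mkTriple (# 5) (# 10) (# 17) , 6) ∷
  (mkTriple (# 5) (# 11) (# 12) , 3) ∷
  (mkTriple (# 5) (# 11) (# 13) , 7) ∷
  (mkTriple (# 5) (# 11) (# 15) , 6) ∷
  (mkTriple (# 5) (# 12) (# 15) , 8) ∷
  (mkTriple (# 5) (# 12) (# 16) , 2) ∷
  (mkTriple (# 5) (# 12) (# 17) , 8) ∷
  (mkTriple (# 5) (# 13) (# 15) , 6) ∷
  (mkTriple (# 5) (# 13) (# 16) , 7) ∷
  (mkTriple (# 6) (# 9) (# 12) , 12) ∷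
  (mkTriple (# 6) (# 9) (# 13) , 6) ∷
  (mkTriple (# 6) (# 9) (# 14) , 11) ∷
  (mkTriple (# 6) (# 9) (# 15) , 10) ∷
  (mkTriple (# 6) (# 9) (# 16) , 18) ∷
  (mkTriple (# 6) (# 9) (# 17) , 14) ∷
  (mkTriple (# 6) (# 10) (# 12) , 10) ∷
  (mkTriple (# 6) (# 10) (# 14) , 13) ∷
  (mkTriple (# 6) (# 10) (# 15) , 11) ∷
  (mkTriple (# 6) (# 10) (# 16) , 13) ∷
  (mkTriple (# 6) (# 10) (# 17) , 16) ∷
  (mkTriple (# 6) (# 11) (# 12) , 4) ∷
  (mkTriple (# 6) (# 11) (# 13) , 12) ∷
  (mkTriple (# 6) (# 11) (# 14) , 8) ∷
  (mkTriple (# 6) (# 11) (# 15) , 10) ∷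
  (mkTriple (# 6) (# 11) (# 16) , 16) ∷
  (mkTriple (# 6) (# 12) (# 15) , 10) ∷
  (mkTriple (# 6) (# 12) (# 16) , 14) ∷
  (mkTriple (# 6) (# 12) (# 17) , 18) ∷
  (mkTriple (# 6) (# 13) (# 15) , 13) ∷
  (mkTriple (# 6) (# 13) (# 16) , 12) ∷
  (mkTriple (# 6) (# 14) (# 15) , 18) ∷
  (mkTriple (# 6) (# 14) (# 16) , 11) ∷
  (mkTriple (# 6) (# 14) (# 17) , 4) ∷
  (mkTriple (# 7) (# 9) (# 12) , 1) ∷
  (mkTriple (# 7) (# 9) (# 13) , 14) ∷
  (mkTriple (# 7) (# 9) (# 14) , 4) ∷
  (mkTriple (# 7) (# 9) (# 15) , 9) ∷
  (mkTriple (# 7) (# 9) (# 16) , 17) ∷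
  (mkTriple (# 7) (# 9) (# 17) , 10) ∷
  (mkTriple (# 7) (# 10) (# 15) , 7) ∷
  (mkTriple (# 7) (# 10) (# 16) , 5) ∷
  (mkTriple (# 7) (# 11) (# 15) , 2) ∷
  (mkTriple (# 7) (# 11) (# 16) , 1) ∷
  (mkTriple (# 7) (# 13) (# 15) , 14) ∷
  (mkTriple (# 7) (# 13) (# 16) , 11) ∷
  (mkTriple (# 8) (# 9) (# 12) , 16) ∷
  (mkTriple (# 8) (# 9) (# 13) , 2) ∷
  (mkTriple (# 8) (# 9) (# 15) , 2) ∷
  (mkTriple (# 8) (# 9) (# 16) , 12) ∷
  (mkTriple (# 8) (# 9) (# 17) , 16) ∷
  (mkTriple (# 8) (# 10) (# 12) , 12) ∷
  (mkTriple (# 8) (# 10) (# 16) , 4) ∷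
  (mkTriple (# 8) (# 10) (# 17) , 7) ∷
  (mkTriple (# 8) (# 11) (# 12) , 8) ∷
  (mkTriple (# 8) (# 11) (# 13) , 13) ∷
  (mkTriple (# 8) (# 11) (# 15) , 10) ∷
  (mkTriple (# 8) (# 11) (# 16) , 6) ∷
  (mkTriple (# 8) (# 12) (# 15) , 10) ∷
  (mkTriple (# 8) (# 12) (# 16) , 14) ∷
  (mkTriple (# 8) (# 12) (# 17) , 10) ∷
  (mkTriple (# 8) (# 13) (# 15) , 1) ∷
  (mkTriple (# 8) (# 13) (# 16) , 9) ∷
  (mkTriple (# 8) (# 13) (# 17) , 2) ∷
  (mkTriple (# 9) (# 12) (# 15) , 19) ∷
  (mkTriple (# 9) (# 12) (# 16) , 10) ∷
  (mkTriple (# 9) (# 12) (# 17) , 13) ∷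
  (mkTriple (# 9) (# 13) (# 15) , 10) ∷
  (mkTriple (# 9) (# 13) (# 16) , 9) ∷
  (mkTriple (# 9) (# 13) (# 17) , 15) ∷
  (mkTriple (# 9) (# 14) (# 15) , 13) ∷
  (mkTriple (# 9) (# 14) (# 16) , 8) ∷
  (mkTriple (# 9) (# 14) (# 17) , 12) ∷
  (mkTriple (# 10) (# 12) (# 15) , 12) ∷
  (mkTriple (# 10) (# 12) (# 16) , 12) ∷
  (mkTriple (# 10) (# 12) (# 17) , 16) ∷
  (mkTriple (# 10) (# 13) (# 15) , 6) ∷
  (mkTriple (# 10) (# 13) (# 16) , 8) ∷
  (mkTriple (# 11) (# 12) (# 15) , 8) ∷
  (mkTriple (# 11) (# 12) (# 16) , 4) ∷
  (mkTriple (# 11) (# 13) (# 15) , 12) ∷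
  (mkTriple (# 11) (# 13) (# 16) , 14) ∷
  (mkTriple (# 11) (# 13) (# 17) , 1) ∷
  (mkTriple (# 11) (# 14) (# 15) , 1) ∷
  []

frequencyOrder : List (Fin 18 × Fin 18)
frequencyOrder =
  (# 8 , # 14) ∷
  (# 1 , # 17) ∷
  (# 3 , # 10) ∷
  (# 7 , # 12) ∷
  (# 7 , # 11) ∷
  (# 7 , # 14) ∷
  (# 4 , # 14) ∷
  (# 11 , # 17) ∷
  (# 2 , # 17) ∷
  (# 2 , # 14) ∷
  (# 5 , # 14) ∷
  (# 0 , # 14) ∷
  (# 4 , # 10) ∷
  (# 3 , # 8) ∷
  (# 10 , # 14) ∷
  (# 4 , # 7) ∷
  (# 14 , # 17) ∷
  (# 3 , # 17) ∷
  (# 7 , # 17) ∷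
  (# 2 , # 10) ∷
  (# 14 , # 16) ∷
  (# 1 , # 4) ∷
  (# 11 , # 14) ∷
  (# 1 , # 8) ∷
  (# 7 , # 10) ∷
  (# 0 , # 3) ∷
  (# 0 , # 7) ∷
  (# 1 , # 14) ∷
  (# 10 , # 13) ∷
  (# 4 , # 17) ∷
  (# 0 , # 8) ∷
  (# 1 , # 11) ∷
  (# 8 , # 10) ∷
  (# 3 , # 16) ∷
  (# 13 , # 17) ∷
  (# 5 , # 16) ∷
  (# 2 , # 4) ∷
  (# 5 , # 11) ∷
  (# 1 , # 10) ∷
  (# 2 , # 6) ∷
  (# 14 , # 15) ∷
  (# 2 , # 16) ∷
  (# 2 , # 3) ∷
  (# 7 , # 16) ∷
  (# 8 , # 15) ∷
  (# 1 , # 13) ∷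
  (# 4 , # 16) ∷
  (# 0 , # 12) ∷
  (# 2 , # 11) ∷
  (# 0 , # 16) ∷
  (# 11 , # 16) ∷
  (# 11 , # 12) ∷
  (# 5 , # 6) ∷
  (# 0 , # 15) ∷
  (# 4 , # 12) ∷
  (# 4 , # 15) ∷
  (# 10 , # 16) ∷
  (# 8 , # 17) ∷
  (# 10 , # 17) ∷
  (# 3 , # 7) ∷
  (# 5 , # 17) ∷
  (# 3 , # 14) ∷
  (# 2 , # 7) ∷
  (# 2 , # 12) ∷
  (# 4 , # 11) ∷
  (# 1 , # 7) ∷
  (# 8 , # 13) ∷
  (# 0 , # 4) ∷
  (# 0 , # 9) ∷
  (# 12 , # 16) ∷
  (# 0 , # 10) ∷
  (# 8 , # 9) ∷
  (# 3 , # 12) ∷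
  (# 1 , # 5) ∷
  (# 10 , # 15) ∷
  (# 6 , # 13) ∷
  (# 12 , # 17) ∷
  (# 4 , # 8) ∷
  (# 6 , # 17) ∷
  (# 4 , # 13) ∷
  (# 1 , # 6) ∷
  (# 3 , # 13) ∷
  (# 8 , # 16) ∷
  (# 5 , # 8) ∷
  (# 1 , # 16) ∷
  (# 9 , # 14) ∷
  (# 0 , # 11) ∷
  (# 5 , # 10) ∷
  (# 1 , # 12) ∷
  (# 8 , # 11) ∷
  (# 2 , # 5) ∷
  (# 5 , # 12) ∷
  (# 0 , # 17) ∷
  (# 6 , # 10) ∷
  (# 7 , # 15) ∷
  (# 0 , # 5) ∷
  (# 5 , # 13) ∷
  (# 7 , # 13) ∷
  (# 3 , # 11) ∷
  (# 6 , # 11) ∷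
  (# 1 , # 3) ∷
  (# 10 , # 12) ∷
  (# 6 , # 14) ∷
  (# 5 , # 15) ∷
  (# 1 , # 15) ∷
  (# 4 , # 9) ∷
  (# 2 , # 8) ∷
  (# 5 , # 7) ∷
  (# 1 , # 9) ∷
  (# 12 , # 15) ∷
  (# 2 , # 9) ∷
  (# 11 , # 15) ∷
  (# 4 , # 6) ∷
  (# 11 , # 13) ∷
  (# 7 , # 9) ∷
  (# 3 , # 6) ∷
  (# 2 , # 13) ∷
  (# 8 , # 12) ∷
  (# 13 , # 16) ∷
  (# 13 , # 15) ∷
  (# 0 , # 13) ∷
  (# 0 , # 6) ∷
  (# 3 , # 9) ∷
  (# 9 , # 17) ∷
  (# 3 , # 15) ∷
  (# 5 , # 9) ∷
  (# 9 , # 16) ∷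
  (# 9 , # 12) ∷
  (# 6 , # 16) ∷
  (# 9 , # 13) ∷
  (# 6 , # 15) ∷
  (# 9 , # 15) ∷
  (# 6 , # 12) ∷
  (# 2 , # 15) ∷
  (# 6 , # 9) ∷
  []

pairWithFrequency : ℕ → Fin 18 × Fin 18
pairWithFrequency k = fromMaybe (# 0 , # 0) (head (drop k frequencyOrder))

frequency : Fin 18 → Fin 18 → ℕ
frequency = weightedFreq weightedBlocks

opaque
  groupOf-sizes : ∀ i → groupSize groupOf i ≡ 3
  groupOf-sizes = toWitness {a? = all? λ i → groupSize groupOf i ≟ℕ 3} _

  frequency-sameGroup : ∀ x y → ¬ x ≡ y → groupOf x ≡ groupOf y → frequency x y ≡ 0
  frequency-sameGroup = toWitness
    {a? = all? λ x → all? λ y → ¬? (x ≟ y) →-dec (groupOf x ≟ groupOf y) →-dec (frequency x y ≟ℕ 0)} _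

  frequency-listed : ∀ x y → ¬ groupOf x ≡ groupOf y →
                     frequency x y < 135 × pairWithFrequency (frequency x y) ≡ᵘ (x , y)
  frequency-listed = toWitness
    {a? = all? λ x → all? λ y → ¬? (groupOf x ≟ groupOf y) →-dec
            (frequency x y <? 135 ×-dec
              (pairWithFrequency (frequency x y) ≟ₚ (x , y) ⊎-dec pairWithFrequency (frequency x y) ≟ₚ (y , x)))} _

  frequency-attained : ∀ {k} → k < 135 →
    ¬ groupOf (proj₁ (pairWithFrequency k)) ≡ groupOf (proj₂ (pairWithFrequency k)) ×
    frequency (proj₁ (pairWithFrequency k)) (proj₂ (pairWithFrequency k)) ≡ k
  frequency-attained = toWitness {a? = allUpTo? (λ k → let (x , y) = pairWithFrequency k in
                                                  ¬? (groupOf x ≟ groupOf y) ×-dec (frequency x y ≟ℕ k)) 135} _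

proposition4p6 : SBGDD 0 3 6
proposition4p6 = sbgdd-from-frequency-order groupOf (expand weightedBlocks) frequency pairWithFrequency
  (freq-expand weightedBlocks) groupOf-sizes frequency-sameGroup
  (λ x y cross → z≤n , frequency-listed x y cross)
  (λ _ → frequency-attained)
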